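{- If $(F,\le,⅋,\lhd,i,+)$ is an MAV-frame, then the poset $(\mathrm{Chu}(F),\sqsubseteq)$ (pairs of $+$-closed lower sets as defined in the context), equipped with $\otimes$, $\lhd$, $I$, $\neg$ as defined there, is an MAV-algebra (with binary meets given by $\&$).
   Context: A pomonoid $(\bullet,e)$ on a poset $(A,\le)$ is a monoid whose operation is monotone in both arguments; commutative if $x\bullet y=y\bullet x$. A $*$-autonomous partial order $(A,\le,\otimes,I,\neg)$: $(\otimes,I)$ a commutative pomonoid, $\neg$ antitone and involutive, with $x\otimes y\le\neg z$ iff $x\le\neg(y\otimes z)$; it satisfies mix if $\neg I=I$. A pomonoid $(\bullet,i)$ is duoidal over a pomonoid $(\lhd,j)$ if $(w\lhd x)\bullet(y\lhd z)\le(w\bullet y)\lhd(x\bullet z)$, $j\bullet j\le j$, $i\le i\lhd i$, $i\le j$. An MAV-algebra $(A,\le,\otimes,\lhd,I,\neg)$: $(A,\le,\otimes,I,\neg)$ is $*$-autonomous with mix; $(\lhd,I)$ is a pomonoid; $\neg(x\lhd y)=\neg x\lhd\neg y$; $(\otimes,I)$ is duoidal over $(\lhd,I)$; $(A,\le)$ has binary meets. An MAV-frame is $(F,\le,⅋,\lhd,i,+)$ with $(F,\le)$ a poset, $(⅋,i)$ a commutative pomonoid, $(\lhd,i)$ a pomonoid, $+$ monotone binary, satisfying $(w\lhd x)⅋(y\lhd z)\le(w⅋y)\lhd(x⅋z)$, $(x+y)⅋z\le(x⅋z)+(y⅋z)$, $(w\lhd x)+(y\lhd z)\le(w+y)\lhd(x+z)$,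 $i+i\le i$. Construction: lower sets are down-closed subsets, $\eta(x)=\{y\mid y\le x\}$. For a lower set $X$, $\alpha(X)=\{x\mid x\le s$ for some finite $+$-combination $s$ (any binary bracketing) of elements of $X\}$. $\mathcal C(F)$ is the set of $+$-closed lower sets ordered by $\subseteq$, with $X\vee Y=\alpha(X\cup Y)$. $K=\eta(i)$, $X\circledast Y=\alpha(\{z\mid z\le x⅋y,x\in X,y\in Y\})$, $X\hat\lhd Y=\{z\mid z\le x\lhd y,x\in X,y\in Y\}$, $X\multimap Y=\{z\mid\forall x\in X,\ z⅋x\in Y\}$. $\mathrm{Chu}(F)$ consists of pairs $(X^+,X^-)\in\mathcal C(F)^2$ with $X^+\circledast X^-\subseteq K$, ordered by $(X^+,X^-)\sqsubseteq(Y^+,Y^-)$ iff $X^+\subseteq Y^+$ and $Y^-\subseteq X^-$; operations $X\otimes Y=(X^+\circledast Y^+,(Y^+\multimap X^-)\cap(X^+\multimap Y^-))$, $I=(K,K)$, $\neg(X^+,X^-)=(X^-,X^+)$, $X\lhd Y=(X^+\hat\lhd Y^+,X^-\hat\lhd Y^-)$, $X\&Y=(X^+\cap Y^+,X^-\vee Y^-)$. -}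

module Defs where

open import Level using (Level; _⊔_; suc; Lift)
open import Data.Product using (Σ; ∃; ∃₂; _×_; _,_)
open import Data.Sum using (_⊎_)
open import Relation.Binary.Core using (Rel)
open import Relation.Binary.Structures using (IsPartialOrder)
open import Relation.Binary.Bundles using (Poset)

-- Generic ordered-algebra notions (over a carrier with an equivalence
-- _≈_ and an order _≤_; equalities of the paper are read up to _≈_).

module _ {a e r : Level} {A : Set a} (_≈_ : Rel A e) (_≤_ : Rel A r) where

  Monotone₂ : (A → A → A) → Set (a ⊔ r)
  Monotone₂ _∙_ = ∀ {x x′ y y′} → x ≤ x′ → y ≤ y′ → (x ∙ y) ≤ (x′ ∙ y′)

  record IsPomonoid (_∙_ : A → A → A) (ε : A) : Set (a ⊔ e ⊔ r) where
    field
      mono      : Monotone₂ _∙_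
      assoc     : ∀ x y z → ((x ∙ y) ∙ z) ≈ (x ∙ (y ∙ z))
      identityˡ : ∀ x → (ε ∙ x) ≈ x
      identityʳ : ∀ x → (x ∙ ε) ≈ x

  record IsCommPomonoid (_∙_ : A → A → A) (ε : A) : Set (a ⊔ e ⊔ r) where
    field
      isPomonoid : IsPomonoid _∙_ ε
      comm       : ∀ x y → (x ∙ y) ≈ (y ∙ x)

  record IsDuoidal (_∙_ : A → A → A) (i : A) (_◃_ : A → A → A) (j : A)
         : Set (a ⊔ r) where
    field
      interchange : ∀ w x y z → ((w ◃ x) ∙ (y ◃ z)) ≤ ((w ∙ y) ◃ (x ∙ z))
      jj≤j        : (j ∙ j) ≤ j
      i≤ii        : i ≤ (i ◃ i)
      i≤j         : i ≤ j

  record IsStarAutonomous (_⊗_ : A → A → A) (I : A) (¬_ : A → A)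
         : Set (a ⊔ e ⊔ r) where
    field
      isPartialOrder : IsPartialOrder _≈_ _≤_
      isCommPomonoid : IsCommPomonoid _⊗_ I
      antitone       : ∀ {x y} → x ≤ y → (¬ y) ≤ (¬ x)
      involutive     : ∀ x → (¬ (¬ x)) ≈ x
      adjunction⇒    : ∀ x y z → (x ⊗ y) ≤ (¬ z) → x ≤ (¬ (y ⊗ z))
      adjunction⇐    : ∀ x y z → x ≤ (¬ (y ⊗ z)) → (x ⊗ y) ≤ (¬ z)

  record IsMeet (_∧_ : A → A → A) : Set (a ⊔ r) where
    field
      lowerˡ   : ∀ x y → (x ∧ y) ≤ x
      lowerʳ   : ∀ x y → (x ∧ y) ≤ y
      greatest : ∀ {x y z} → z ≤ x → z ≤ y → z ≤ (x ∧ y)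

  record IsMAVAlgebra (_⊗_ _◃_ : A → A → A) (I : A) (¬_ : A → A)
         (_&_ : A → A → A) : Set (a ⊔ e ⊔ r) where
    field
      isStarAutonomous : IsStarAutonomous _⊗_ I ¬_
      mix              : (¬ I) ≈ I
      ◃-isPomonoid     : IsPomonoid _◃_ I
      ¬-◃              : ∀ x y → (¬ (x ◃ y)) ≈ ((¬ x) ◃ (¬ y))
      isDuoidal        : IsDuoidal _⊗_ I _◃_ I
      isMeet           : IsMeet _&_

record MAVFrame (c ℓ₁ ℓ₂ : Level) : Set (suc (c ⊔ ℓ₁ ⊔ ℓ₂)) where
  infixl 6 _+_
  field
    poset : Poset c ℓ₁ ℓ₂
  open Poset poset public using (Carrier; _≈_; _≤_)
  field
    _⅋_ : Carrier → Carrier → Carrier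
    _◃_ : Carrier → Carrier → Carrier
    i   : Carrier
    _+_ : Carrier → Carrier → Carrier
    ⅋-isCommPomonoid : IsCommPomonoid _≈_ _≤_ _⅋_ i
    ◃-isPomonoid     : IsPomonoid _≈_ _≤_ _◃_ i
    +-mono           : Monotone₂ _≈_ _≤_ _+_
    ⅋-◃-interchange  : ∀ w x y z → ((w ◃ x) ⅋ (y ◃ z)) ≤ ((w ⅋ y) ◃ (x ⅋ z))
    +-⅋-distrib      : ∀ x y z → ((x + y) ⅋ z) ≤ ((x ⅋ z) + (y ⅋ z))
    +-◃-interchange  : ∀ w x y z → ((w ◃ x) + (y ◃ z)) ≤ ((w + y) ◃ (x + z))
    i+i≤i            : (i + i) ≤ i

module ChuConstruction {c ℓ₁ ℓ₂ : Level} (𝔽 : MAVFrame c ℓ₁ ℓ₂) where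
  open MAVFrame 𝔽

  ℓP : Level
  ℓP = c ⊔ ℓ₂

  PSet : Set (suc ℓP)
  PSet = Carrier → Set ℓP

  _⊆_ : PSet → PSet → Set ℓP
  X ⊆ Y = ∀ x → X x → Y x

  _∩_ : PSet → PSet → PSet
  (X ∩ Y) z = X z × Y z

  _∪_ : PSet → PSet → PSet
  (X ∪ Y) z = X z ⊎ Y z

  IsLowerSet : PSet → Set ℓP
  IsLowerSet X = ∀ {x y} → y ≤ x → X x → X y

  -- closure under +  (for lower sets, equivalent to α(X) ⊆ X)
  IsPlusClosed : PSet → Set ℓP
  IsPlusClosed X = ∀ {x y} → X x → X y → X (x + y)

  η : Carrier → PSet
  η x y = Lift c (y ≤ x)

  data Comb (X : PSet) : Carrier → Set ℓP where
    leaf : ∀ {x} → X x → Comb X x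
    node : ∀ {x y} → Comb X x → Comb X y → Comb X (x + y)

  α : PSet → PSet
  α X z = ∃ λ s → Comb X s × z ≤ s

  _∨_ : PSet → PSet → PSet
  X ∨ Y = α (X ∪ Y)

  K : PSet
  K = η i

  _⊛_ : PSet → PSet → PSet
  X ⊛ Y = α (λ z → ∃₂ λ x y → X x × Y y × z ≤ (x ⅋ y))

  _◃̂_ : PSet → PSet → PSet
  (X ◃̂ Y) z = ∃₂ λ x y → X x × Y y × z ≤ (x ◃ y)

  _⊸_ : PSet → PSet → PSet
  (X ⊸ Y) z = ∀ x → X x → Y (z ⅋ x)

  record IsChu (P N : PSet) : Set ℓP where
    field
      pos-lower : IsLowerSet P
      pos-plus  : IsPlusClosed P
      neg-lower : IsLowerSet N
      neg-plus  : IsPlusClosed N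
      compat    : (P ⊛ N) ⊆ K

  record Chu : Set (suc ℓP) where
    constructor chu
    field
      pos   : PSet
      neg   : PSet
      isChu : IsChu pos neg
  open Chu public

  _⊑_ : Chu → Chu → Set ℓP
  X ⊑ Y = (pos X ⊆ pos Y) × (neg Y ⊆ neg X)

  _≈ᶜ_ : Chu → Chu → Set ℓP
  X ≈ᶜ Y = (X ⊑ Y) × (Y ⊑ X)

  -- Well-definedness of the operations: the defining pairs lie in Chu(F)
  record ChuClosed : Set (suc ℓP) where
    field
      ⊗-closed : ∀ X Y → IsChu (pos X ⊛ pos Y)
                               ((pos Y ⊸ neg X) ∩ (pos X ⊸ neg Y))
      I-closed : IsChu K K
      ¬-closed : ∀ X → IsChu (neg X) (pos X)
      ◃-closed : ∀ X Y → IsChu (pos X ◃̂ pos Y) (neg X ◃̂ neg Y)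
      &-closed : ∀ X Y → IsChu (pos X ∩ pos Y) (neg X ∨ neg Y)

  module Ops (cl : ChuClosed) where
    open ChuClosed cl

    _⊗ᶜ_ : Chu → Chu → Chu
    X ⊗ᶜ Y = chu (pos X ⊛ pos Y) ((pos Y ⊸ neg X) ∩ (pos X ⊸ neg Y)) (⊗-closed X Y)

    Iᶜ : Chu
    Iᶜ = chu K K I-closed

    ¬ᶜ : Chu → Chu
    ¬ᶜ X = chu (neg X) (pos X) (¬-closed X)

    _◃ᶜ_ : Chu → Chu → Chu
    X ◃ᶜ Y = chu (pos X ◃̂ pos Y) (neg X ◃̂ neg Y) (◃-closed X Y)

    _&ᶜ_ : Chu → Chu → Chu
    X &ᶜ Y = chu (pos X ∩ pos Y) (neg X ∨ neg Y) (&-closed X Y)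

  ChuIsMAV : Set (suc ℓP)
  ChuIsMAV = Σ ChuClosed λ cl →
    let open Ops cl in IsMAVAlgebra _≈ᶜ_ _⊑_ _⊗ᶜ_ _◃ᶜ_ Iᶜ ¬ᶜ _&ᶜ_

{-# OPTIONS --safe #-}
module Submission where

-- The +-closed lower sets of F form a residuated structure: α is the closure
-- operator, and for closed C one has A ⊛ B ⊆ C iff A ⊆ B ⊸ C.  The frame laws
-- of ⅋ turn into currying and exchange for ⊸, and those of ◃ and + lift
-- pointwise to ◃̂.  A Chu pair is then a pair of closed sets with X⁺ ⊆ X⁻ ⊸ K,
-- and each MAV-algebra law for Chu(F) splits into an inclusion of positive
-- parts and a reversed one of negative parts, both instances of these facts.
-- Associativity of ⊗ is needed in one direction only: rotating with
-- commutativity gives the other.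

open import Level using (Level; lift)
open import Data.Product as Product using (_,_; proj₁; proj₂; swap)
open import Data.Sum using (inj₁; inj₂; [_,_]′)
open import Function using (_∘_)
open import Relation.Binary.Bundles using (Poset)
open import Relation.Binary.Structures using (IsPreorder; IsPartialOrder)
open import Relation.Binary.PropositionalEquality as ≡ using (_≡_; refl)
import Relation.Binary.Reasoning.Base.Double as DoubleReasoning
open import Relation.Binary.Reasoning.Syntax using (module ⊆-syntax; module ⊑-syntax)
open import Relation.Unary.Properties using (⊆′-refl; ⊆′-trans)
open import Defs

module MAVFrameChu {c ℓ₁ ℓ₂ : Level} (𝔽 : MAVFrame c ℓ₁ ℓ₂) where
  open MAVFrame 𝔽
  open ChuConstruction 𝔽
  open Poset poset using (reflexive; module Eq) renaming (refl to ≤-refl; trans to ≤-trans)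
  open IsCommPomonoid ⅋-isCommPomonoid using () renaming (comm to ⅋-comm)
  open IsPomonoid (IsCommPomonoid.isPomonoid ⅋-isCommPomonoid) using ()
    renaming (mono to ⅋-mono; assoc to ⅋-assoc; identityˡ to ⅋-identityˡ; identityʳ to ⅋-identityʳ)
  open IsPomonoid ◃-isPomonoid using ()
    renaming (mono to ◃-mono; assoc to ◃-assoc; identityˡ to ◃-identityˡ; identityʳ to ◃-identityʳ)

  ⅋-distribˡ-+ : ∀ x y z → (x ⅋ (y + z)) ≤ ((x ⅋ y) + (x ⅋ z))
  ⅋-distribˡ-+ x y z = begin
    x ⅋ (y + z)           ≈⟨ ⅋-comm x (y + z) ⟩
    (y + z) ⅋ x           ≤⟨ +-⅋-distrib y z x ⟩
    (y ⅋ x) + (z ⅋ x)     ≤⟨ +-mono (reflexive (⅋-comm y x)) (reflexive (⅋-comm z x)) ⟩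
    (x ⅋ y) + (x ⅋ z)     ∎
    where open import Relation.Binary.Reasoning.PartialOrder poset

  ⅋-exchange : ∀ x y z → ((x ⅋ y) ⅋ z) ≤ ((x ⅋ z) ⅋ y)
  ⅋-exchange x y z = begin
    (x ⅋ y) ⅋ z  ≈⟨ ⅋-assoc x y z ⟩
    x ⅋ (y ⅋ z)  ≤⟨ ⅋-mono ≤-refl (reflexive (⅋-comm y z)) ⟩
    x ⅋ (z ⅋ y)  ≈⟨ ⅋-assoc x z y ⟨
    (x ⅋ z) ⅋ y  ∎
    where open import Relation.Binary.Reasoning.PartialOrder poset

  -- The _⊆_ of Defs is definitionally the _⊆′_ of Relation.Unary.
  ⊆-isPreorder : IsPreorder _≡_ _⊆_
  ⊆-isPreorder = record
    { isEquivalence = ≡.isEquivalence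
    ; reflexive     = λ { refl → ⊆′-refl }
    ; trans         = ⊆′-trans
    }

  module ⊆-Reasoning where
    private module Base = DoubleReasoning ⊆-isPreorder
    open Base public using (begin_; _∎)
    open ⊆-syntax Base._IsRelatedTo_ Base._IsRelatedTo_ Base.≲-go public

  ∩-⊆ˡ : ∀ {A B} → (A ∩ B) ⊆ A
  ∩-⊆ˡ _ = proj₁

  ∩-⊆ʳ : ∀ {A B} → (A ∩ B) ⊆ B
  ∩-⊆ʳ _ = proj₂

  ⊆-∩ : ∀ {A B C} → A ⊆ B → A ⊆ C → A ⊆ (B ∩ C)
  ⊆-∩ A⊆B A⊆C x Ax = A⊆B x Ax , A⊆C x Ax

  ∩-mono : ∀ {A A′ B B′} → A ⊆ A′ → B ⊆ B′ → (A ∩ B) ⊆ (A′ ∩ B′)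
  ∩-mono A⊆A′ B⊆B′ x = Product.map (A⊆A′ x) (B⊆B′ x)

  record IsClosed (X : PSet) : Set ℓP where
    field
      isLowerSet   : IsLowerSet X
      isPlusClosed : IsPlusClosed X
  open IsClosed

  α-isClosed : ∀ {S} → IsClosed (α S)
  α-isClosed = record
    { isLowerSet   = λ { y≤x (s , Ss , x≤s) → s , Ss , ≤-trans y≤x x≤s }
    ; isPlusClosed = λ { (s , Ss , x≤s) (t , St , y≤t) → s + t , node Ss St , +-mono x≤s y≤t }
    }

  ⊆-α : ∀ {S} → S ⊆ α S
  ⊆-α x Sx = x , leaf Sx , ≤-refl

  α-least : ∀ {S C} → IsClosed C → S ⊆ C → α S ⊆ C
  α-least {S} {C} C-closed S⊆C z (s , Ss , z≤s) = isLowerSet C-closed z≤s (combination Ss)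
    where
    combination : ∀ {s} → Comb S s → C s
    combination (leaf Ss)   = S⊆C _ Ss
    combination (node p q) = isPlusClosed C-closed (combination p) (combination q)

  preimage-isClosed : ∀ {C} (f : Carrier → Carrier) → (∀ {x y} → x ≤ y → f x ≤ f y) →
                      (∀ x y → f (x + y) ≤ (f x + f y)) → IsClosed C → IsClosed (C ∘ f)
  preimage-isClosed f f-mono f-subadditive C-closed = record
    { isLowerSet   = λ y≤x → isLowerSet C-closed (f-mono y≤x)
    ; isPlusClosed = λ {x} {y} Cfx Cfy →
        isLowerSet C-closed (f-subadditive x y) (isPlusClosed C-closed Cfx Cfy)
    }

  ∩-isClosed : ∀ {A B} → IsClosed A → IsClosed B → IsClosed (A ∩ B)
  ∩-isClosed A-closed B-closed = record
    { isLowerSet   = λ y≤x → Product.map (isLowerSet A-closed y≤x) (isLowerSet B-closed y≤x)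
    ; isPlusClosed = λ (Ax , Bx) (Ay , By) →
        isPlusClosed A-closed Ax Ay , isPlusClosed B-closed Bx By
    }

  K-isClosed : IsClosed K
  K-isClosed = record
    { isLowerSet   = λ { y≤x (lift x≤i) → lift (≤-trans y≤x x≤i) }
    ; isPlusClosed = λ { (lift x≤i) (lift y≤i) → lift (≤-trans (+-mono x≤i y≤i) i+i≤i) }
    }

  ◃̂-isClosed : ∀ {A B} → IsPlusClosed A → IsPlusClosed B → IsClosed (A ◃̂ B)
  ◃̂-isClosed A-plus B-plus = record
    { isLowerSet   = λ { y≤x (a , b , Aa , Bb , x≤ab) → a , b , Aa , Bb , ≤-trans y≤x x≤ab }
    ; isPlusClosed = λ { (a , b , Aa , Bb , x≤ab) (a′ , b′ , Aa′ , Bb′ , y≤ab′) →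
        a + a′ , b + b′ , A-plus Aa Aa′ , B-plus Bb Bb′ ,
        ≤-trans (+-mono x≤ab y≤ab′) (+-◃-interchange a b a′ b′) }
    }

  ⊸-isClosed : ∀ {A C} → IsClosed C → IsClosed (A ⊸ C)
  ⊸-isClosed {C = C} C-closed = record
    { isLowerSet   = λ y≤x f a Aa → isLowerSet (⅋a-preimage a) y≤x (f a Aa)
    ; isPlusClosed = λ f g a Aa → isPlusClosed (⅋a-preimage a) (f a Aa) (g a Aa)
    }
    where
    ⅋a-preimage : ∀ a → IsClosed (λ x → C (x ⅋ a))
    ⅋a-preimage a =
      preimage-isClosed (_⅋ a) (λ x≤y → ⅋-mono x≤y ≤-refl) (λ x y → +-⅋-distrib x y a) C-closed

  ⊸-α : ∀ {S C} → IsClosed C → (S ⊸ C) ⊆ (α S ⊸ C)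
  ⊸-α C-closed n = α-least (preimage-isClosed (n ⅋_) (⅋-mono ≤-refl) (⅋-distribˡ-+ n) C-closed)

  ⊸-mono : ∀ {A A′ C C′} → A′ ⊆ A → C ⊆ C′ → (A ⊸ C) ⊆ (A′ ⊸ C′)
  ⊸-mono A′⊆A C⊆C′ n f a A′a = C⊆C′ _ (f a (A′⊆A a A′a))

  ⊸-∨ : ∀ {A B C} → IsClosed C → ((A ⊸ C) ∩ (B ⊸ C)) ⊆ ((A ∨ B) ⊸ C)
  ⊸-∨ C-closed n (f , g) = ⊸-α C-closed n (λ x → [ f x , g x ]′)

  ⊸-swap : ∀ {A B C} → IsLowerSet C → A ⊆ (B ⊸ C) → B ⊆ (A ⊸ C)
  ⊸-swap C-lower A⊆B⊸C b Bb a Aa = C-lower (reflexive (⅋-comm b a)) (A⊆B⊸C a Aa b Bb)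

  ⊸-exchange : ∀ {A B C} → IsLowerSet C → (A ⊸ (B ⊸ C)) ⊆ (B ⊸ (A ⊸ C))
  ⊸-exchange C-lower n f b Bb a Aa = C-lower (⅋-exchange n b a) (f a Aa b Bb)

  ⊛-intro : ∀ {A B a b} → A a → B b → (A ⊛ B) (a ⅋ b)
  ⊛-intro Aa Bb = ⊆-α _ (_ , _ , Aa , Bb , ≤-refl)

  ⊛⊆⇒⊆⊸ : ∀ {A B C} → (A ⊛ B) ⊆ C → A ⊆ (B ⊸ C)
  ⊛⊆⇒⊆⊸ A⊛B⊆C a Aa b Bb = A⊛B⊆C _ (⊛-intro Aa Bb)

  ⊆⊸⇒⊛⊆ : ∀ {A B C} → IsClosed C → A ⊆ (B ⊸ C) → (A ⊛ B) ⊆ C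
  ⊆⊸⇒⊛⊆ C-closed A⊆B⊸C = α-least C-closed λ where
    z (a , b , Aa , Bb , z≤ab) → isLowerSet C-closed z≤ab (A⊆B⊸C a Aa b Bb)

  ⊸-curry : ∀ {A B C} → IsLowerSet C → ((A ⊛ B) ⊸ C) ⊆ (A ⊸ (B ⊸ C))
  ⊸-curry C-lower n f a Aa b Bb = C-lower (reflexive (⅋-assoc n a b)) (f _ (⊛-intro Aa Bb))

  ⊸-uncurry : ∀ {A B C} → IsClosed C → (A ⊸ (B ⊸ C)) ⊆ ((A ⊛ B) ⊸ C)
  ⊸-uncurry C-closed n f = ⊸-α C-closed n λ where
    p (a , b , Aa , Bb , p≤ab) →
      isLowerSet C-closed (≤-trans (⅋-mono ≤-refl p≤ab) (reflexive (Eq.sym (⅋-assoc n a b))))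
        (f a Aa b Bb)

  ⊛-mono : ∀ {A A′ B B′} → A ⊆ A′ → B ⊆ B′ → (A ⊛ B) ⊆ (A′ ⊛ B′)
  ⊛-mono A⊆A′ B⊆B′ = ⊆⊸⇒⊛⊆ α-isClosed λ a Aa b Bb → ⊛-intro (A⊆A′ a Aa) (B⊆B′ b Bb)

  ⊛-comm : ∀ {A B} → (A ⊛ B) ⊆ (B ⊛ A)
  ⊛-comm = ⊆⊸⇒⊛⊆ α-isClosed λ a Aa b Bb →
    isLowerSet α-isClosed (reflexive (⅋-comm a b)) (⊛-intro Bb Aa)

  -- For D = A ⊛ (B ⊛ C): A ⊆ (B ⊛ C) ⊸ D curries to A ⊆ B ⊸ (C ⊸ D); now residuate twice.
  ⊛-assoc : ∀ {A B C} → ((A ⊛ B) ⊛ C) ⊆ (A ⊛ (B ⊛ C))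
  ⊛-assoc = ⊆⊸⇒⊛⊆ α-isClosed (⊆⊸⇒⊛⊆ (⊸-isClosed α-isClosed)
              (⊆′-trans (⊛⊆⇒⊆⊸ ⊆′-refl) (⊸-curry (isLowerSet α-isClosed))))

  K⊛A⊆A : ∀ {A} → IsClosed A → (K ⊛ A) ⊆ A
  K⊛A⊆A A-closed = ⊆⊸⇒⊛⊆ A-closed λ where
    k (lift k≤i) a Aa →
      isLowerSet A-closed (≤-trans (⅋-mono k≤i ≤-refl) (reflexive (⅋-identityˡ a))) Aa

  A⊆K⊛A : ∀ {A} → A ⊆ (K ⊛ A)
  A⊆K⊛A a Aa = isLowerSet α-isClosed (reflexive (Eq.sym (⅋-identityˡ a))) (⊛-intro (lift ≤-refl) Aa)

  K⊸C⊆C : ∀ {C} → IsLowerSet C → (K ⊸ C) ⊆ C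
  K⊸C⊆C C-lower n f = C-lower (reflexive (Eq.sym (⅋-identityʳ n))) (f i (lift ≤-refl))

  C⊆K⊸C : ∀ {C} → IsLowerSet C → C ⊆ (K ⊸ C)
  C⊆K⊸C C-lower n Cn k (lift k≤i) =
    C-lower (≤-trans (⅋-mono ≤-refl k≤i) (reflexive (⅋-identityʳ n))) Cn

  ◃̂-mono : ∀ {A A′ B B′} → A ⊆ A′ → B ⊆ B′ → (A ◃̂ B) ⊆ (A′ ◃̂ B′)
  ◃̂-mono A⊆A′ B⊆B′ z (a , b , Aa , Bb , z≤ab) = a , b , A⊆A′ a Aa , B⊆B′ b Bb , z≤ab

  ◃̂-assoc⇒ : ∀ {A B C} → ((A ◃̂ B) ◃̂ C) ⊆ (A ◃̂ (B ◃̂ C))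
  ◃̂-assoc⇒ w (p , c , (a , b , Aa , Bb , p≤ab) , Cc , w≤pc) =
    a , b ◃ c , Aa , (b , c , Bb , Cc , ≤-refl) ,
    ≤-trans w≤pc (≤-trans (◃-mono p≤ab ≤-refl) (reflexive (◃-assoc a b c)))

  ◃̂-assoc⇐ : ∀ {A B C} → (A ◃̂ (B ◃̂ C)) ⊆ ((A ◃̂ B) ◃̂ C)
  ◃̂-assoc⇐ w (a , q , Aa , (b , c , Bb , Cc , q≤bc) , w≤aq) =
    a ◃ b , c , (a , b , Aa , Bb , ≤-refl) , Cc ,
    ≤-trans w≤aq (≤-trans (◃-mono ≤-refl q≤bc) (reflexive (Eq.sym (◃-assoc a b c))))

  K◃̂A⊆A : ∀ {A} → IsLowerSet A → (K ◃̂ A) ⊆ A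
  K◃̂A⊆A A-lower z (k , a , lift k≤i , Aa , z≤ka) =
    A-lower (≤-trans z≤ka (≤-trans (◃-mono k≤i ≤-refl) (reflexive (◃-identityˡ a)))) Aa

  A⊆K◃̂A : ∀ {A} → A ⊆ (K ◃̂ A)
  A⊆K◃̂A a Aa = i , a , lift ≤-refl , Aa , reflexive (Eq.sym (◃-identityˡ a))

  A◃̂K⊆A : ∀ {A} → IsLowerSet A → (A ◃̂ K) ⊆ A
  A◃̂K⊆A A-lower z (a , k , Aa , lift k≤i , z≤ak) =
    A-lower (≤-trans z≤ak (≤-trans (◃-mono ≤-refl k≤i) (reflexive (◃-identityʳ a)))) Aa

  A⊆A◃̂K : ∀ {A} → A ⊆ (A ◃̂ K)
  A⊆A◃̂K a Aa = a , i , Aa , lift ≤-refl , reflexive (Eq.sym (◃-identityʳ a))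

  ◃̂-⊸-interchange : ∀ {A B C D} → ((A ⊸ C) ◃̂ (B ⊸ D)) ⊆ ((A ◃̂ B) ⊸ (C ◃̂ D))
  ◃̂-⊸-interchange m (p , q , f , g , m≤pq) r (a , b , Aa , Bb , r≤ab) =
    p ⅋ a , q ⅋ b , f a Aa , g b Bb , ≤-trans (⅋-mono m≤pq r≤ab) (⅋-◃-interchange p q a b)

  ⊛-◃̂-interchange : ∀ {A B C D} → ((A ◃̂ B) ⊛ (C ◃̂ D)) ⊆ ((A ⊛ C) ◃̂ (B ⊛ D))
  ⊛-◃̂-interchange = ⊆⊸⇒⊛⊆ (◃̂-isClosed (isPlusClosed α-isClosed) (isPlusClosed α-isClosed))
    (⊆′-trans (◃̂-mono (⊛⊆⇒⊆⊸ ⊆′-refl) (⊛⊆⇒⊆⊸ ⊆′-refl)) ◃̂-⊸-interchange)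

  isChu-intro : ∀ {P N} → IsClosed P → IsClosed N → P ⊆ (N ⊸ K) → IsChu P N
  isChu-intro P-closed N-closed P⊆N⊸K = record
    { pos-lower = isLowerSet P-closed
    ; pos-plus  = isPlusClosed P-closed
    ; neg-lower = isLowerSet N-closed
    ; neg-plus  = isPlusClosed N-closed
    ; compat    = ⊆⊸⇒⊛⊆ K-isClosed P⊆N⊸K
    }

  module _ (X : Chu) where
    open IsChu (isChu X)

    pos-isClosed : IsClosed (pos X)
    pos-isClosed = record { isLowerSet = pos-lower ; isPlusClosed = pos-plus }

    neg-isClosed : IsClosed (neg X)
    neg-isClosed = record { isLowerSet = neg-lower ; isPlusClosed = neg-plus }

    pos⊆neg⊸K : pos X ⊆ (neg X ⊸ K)
    pos⊆neg⊸K = ⊛⊆⇒⊆⊸ compat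

    neg⊆pos⊸K : neg X ⊆ (pos X ⊸ K)
    neg⊆pos⊸K = ⊸-swap (isLowerSet K-isClosed) pos⊆neg⊸K

  ⊗-pos⊆neg⊸K : ∀ X Y → (pos X ⊛ pos Y) ⊆ (((pos Y ⊸ neg X) ∩ (pos X ⊸ neg Y)) ⊸ K)
  ⊗-pos⊆neg⊸K X Y = ⊸-swap (isLowerSet K-isClosed) (begin
    (pos Y ⊸ neg X) ∩ (pos X ⊸ neg Y)  ⊆⟨ ∩-⊆ˡ ⟩
    pos Y ⊸ neg X                      ⊆⟨ ⊸-mono ⊆′-refl (neg⊆pos⊸K X) ⟩
    pos Y ⊸ (pos X ⊸ K)                ⊆⟨ ⊸-exchange (isLowerSet K-isClosed) ⟩
    pos X ⊸ (pos Y ⊸ K)                ⊆⟨ ⊸-uncurry K-isClosed ⟩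
    (pos X ⊛ pos Y) ⊸ K                ∎)
    where open ⊆-Reasoning

  ◃-pos⊆neg⊸K : ∀ X Y → (pos X ◃̂ pos Y) ⊆ ((neg X ◃̂ neg Y) ⊸ K)
  ◃-pos⊆neg⊸K X Y = begin
    pos X ◃̂ pos Y              ⊆⟨ ◃̂-mono (pos⊆neg⊸K X) (pos⊆neg⊸K Y) ⟩
    (neg X ⊸ K) ◃̂ (neg Y ⊸ K)  ⊆⟨ ◃̂-⊸-interchange ⟩
    (neg X ◃̂ neg Y) ⊸ (K ◃̂ K)  ⊆⟨ ⊸-mono ⊆′-refl (K◃̂A⊆A (isLowerSet K-isClosed)) ⟩
    (neg X ◃̂ neg Y) ⊸ K        ∎
    where open ⊆-Reasoning

  &-pos⊆neg⊸K : ∀ X Y → (pos X ∩ pos Y) ⊆ ((neg X ∨ neg Y) ⊸ K)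
  &-pos⊆neg⊸K X Y = ⊆′-trans (∩-mono (pos⊆neg⊸K X) (pos⊆neg⊸K Y)) (⊸-∨ K-isClosed)

  chuClosed : ChuClosed
  chuClosed = record
    { ⊗-closed = λ X Y → isChu-intro α-isClosed
                   (∩-isClosed (⊸-isClosed (neg-isClosed X)) (⊸-isClosed (neg-isClosed Y)))
                   (⊗-pos⊆neg⊸K X Y)
    ; I-closed = isChu-intro K-isClosed K-isClosed (C⊆K⊸C (isLowerSet K-isClosed))
    ; ¬-closed = λ X → isChu-intro (neg-isClosed X) (pos-isClosed X) (neg⊆pos⊸K X)
    ; ◃-closed = λ X Y → isChu-intro
                   (◃̂-isClosed (isPlusClosed (pos-isClosed X)) (isPlusClosed (pos-isClosed Y)))
                   (◃̂-isClosed (isPlusClosed (neg-isClosed X)) (isPlusClosed (neg-isClosed Y)))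
                   (◃-pos⊆neg⊸K X Y)
    ; &-closed = λ X Y → isChu-intro (∩-isClosed (pos-isClosed X) (pos-isClosed Y)) α-isClosed
                   (&-pos⊆neg⊸K X Y)
    }

  open Ops chuClosed public

  ⊑-refl : ∀ X → X ⊑ X
  ⊑-refl X = ⊆′-refl , ⊆′-refl

  ≈ᶜ-refl : ∀ X → X ≈ᶜ X
  ≈ᶜ-refl X = ⊑-refl X , ⊑-refl X

  -- _⊑_ only sees the underlying sets, so implicit Chu arguments are never
  -- inferred and must be passed explicitly where _⊑_ is expected.
  ⊑-trans : ∀ {X Y Z} → X ⊑ Y → Y ⊑ Z → X ⊑ Z
  ⊑-trans (pX⊆pY , nY⊆nX) (pY⊆pZ , nZ⊆nY) = ⊆′-trans pX⊆pY pY⊆pZ , ⊆′-trans nZ⊆nY nY⊆nX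

  ⊑-isPartialOrder : IsPartialOrder _≈ᶜ_ _⊑_
  ⊑-isPartialOrder = record
    { isPreorder = record
      { isEquivalence = record
        { refl  = λ {X} → ≈ᶜ-refl X
        ; sym   = swap
        ; trans = λ {X} {Y} {Z} (X⊑Y , Y⊑X) (Y⊑Z , Z⊑Y) →
                    ⊑-trans {X} {Y} {Z} X⊑Y Y⊑Z , ⊑-trans {Z} {Y} {X} Z⊑Y Y⊑X
        }
      ; reflexive = proj₁
      ; trans     = λ {X} {Y} {Z} → ⊑-trans {X} {Y} {Z}
      }
    ; antisym = _,_
    }

  module ⊑-Reasoning where
    private module Base = DoubleReasoning (IsPartialOrder.isPreorder ⊑-isPartialOrder)
    open Base public using (begin_; _∎)
    open ⊑-syntax Base._IsRelatedTo_ Base._IsRelatedTo_ Base.≲-go public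

  ⊗-mono : ∀ {X X′ Y Y′} → X ⊑ X′ → Y ⊑ Y′ → (X ⊗ᶜ Y) ⊑ (X′ ⊗ᶜ Y′)
  ⊗-mono (pX , nX) (pY , nY) = ⊛-mono pX pY , ∩-mono (⊸-mono pY nX) (⊸-mono pX nY)

  ⊗-comm : ∀ X Y → (X ⊗ᶜ Y) ⊑ (Y ⊗ᶜ X)
  ⊗-comm X Y = ⊛-comm , λ _ → swap

  ⊗-assoc⇒ : ∀ X Y Z → ((X ⊗ᶜ Y) ⊗ᶜ Z) ⊑ (X ⊗ᶜ (Y ⊗ᶜ Z))
  ⊗-assoc⇒ X Y Z = ⊛-assoc , λ n (f , g) →
      (λ z Zz → ⊸-exchange X⁻-lower n (⊸-curry X⁻-lower n f) z Zz
              , ⊸-exchange Y⁻-lower n (λ x Xx → proj₁ (g x Xx)) z Zz)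
    , ⊸-uncurry (neg-isClosed Z) n (λ x Xx → proj₂ (g x Xx))
    where
    X⁻-lower = isLowerSet (neg-isClosed X)
    Y⁻-lower = isLowerSet (neg-isClosed Y)

  ⊗-assoc⇐ : ∀ X Y Z → (X ⊗ᶜ (Y ⊗ᶜ Z)) ⊑ ((X ⊗ᶜ Y) ⊗ᶜ Z)
  ⊗-assoc⇐ X Y Z = begin
    X ⊗ᶜ (Y ⊗ᶜ Z)  ⊑⟨ ⊗-comm X (Y ⊗ᶜ Z) ⟩
    (Y ⊗ᶜ Z) ⊗ᶜ X  ⊑⟨ ⊗-assoc⇒ Y Z X ⟩
    Y ⊗ᶜ (Z ⊗ᶜ X)  ⊑⟨ ⊗-comm Y (Z ⊗ᶜ X) ⟩
    (Z ⊗ᶜ X) ⊗ᶜ Y  ⊑⟨ ⊗-assoc⇒ Z X Y ⟩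
    Z ⊗ᶜ (X ⊗ᶜ Y)  ⊑⟨ ⊗-comm Z (X ⊗ᶜ Y) ⟩
    (X ⊗ᶜ Y) ⊗ᶜ Z  ∎
    where open ⊑-Reasoning

  ⊗-identityˡ⇒ : ∀ X → (Iᶜ ⊗ᶜ X) ⊑ X
  ⊗-identityˡ⇒ X = K⊛A⊆A (pos-isClosed X) , ⊆-∩ (neg⊆pos⊸K X) (C⊆K⊸C (isLowerSet (neg-isClosed X)))

  ⊗-identityˡ⇐ : ∀ X → X ⊑ (Iᶜ ⊗ᶜ X)
  ⊗-identityˡ⇐ X = A⊆K⊛A , ⊆′-trans ∩-⊆ʳ (K⊸C⊆C (isLowerSet (neg-isClosed X)))

  ⊗-identityʳ⇒ : ∀ X → (X ⊗ᶜ Iᶜ) ⊑ X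
  ⊗-identityʳ⇒ X = begin
    X ⊗ᶜ Iᶜ  ⊑⟨ ⊗-comm X Iᶜ ⟩
    Iᶜ ⊗ᶜ X  ⊑⟨ ⊗-identityˡ⇒ X ⟩
    X        ∎
    where open ⊑-Reasoning

  ⊗-identityʳ⇐ : ∀ X → X ⊑ (X ⊗ᶜ Iᶜ)
  ⊗-identityʳ⇐ X = begin
    X        ⊑⟨ ⊗-identityˡ⇐ X ⟩
    Iᶜ ⊗ᶜ X  ⊑⟨ ⊗-comm Iᶜ X ⟩
    X ⊗ᶜ Iᶜ  ∎
    where open ⊑-Reasoning

  ⊗-adjunction⇒ : ∀ X Y Z → (X ⊗ᶜ Y) ⊑ ¬ᶜ Z → X ⊑ ¬ᶜ (Y ⊗ᶜ Z)
  ⊗-adjunction⇒ X Y Z (X⁺⊛Y⁺⊆Z⁻ , Z⁺⊆Y⁺⊸X⁻∩X⁺⊸Y⁻) =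
      ⊆-∩ (⊸-swap (isLowerSet (neg-isClosed Y)) (⊆′-trans Z⁺⊆Y⁺⊸X⁻∩X⁺⊸Y⁻ ∩-⊆ʳ))
          (⊛⊆⇒⊆⊸ X⁺⊛Y⁺⊆Z⁻)
    , ⊆⊸⇒⊛⊆ (neg-isClosed X) (⊸-swap (isLowerSet (neg-isClosed X)) (⊆′-trans Z⁺⊆Y⁺⊸X⁻∩X⁺⊸Y⁻ ∩-⊆ˡ))

  ⊗-adjunction⇐ : ∀ X Y Z → X ⊑ ¬ᶜ (Y ⊗ᶜ Z) → (X ⊗ᶜ Y) ⊑ ¬ᶜ Z
  ⊗-adjunction⇐ X Y Z (X⁺⊆Z⁺⊸Y⁻∩Y⁺⊸Z⁻ , Y⁺⊛Z⁺⊆X⁻) =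
      ⊆⊸⇒⊛⊆ (neg-isClosed Z) (⊆′-trans X⁺⊆Z⁺⊸Y⁻∩Y⁺⊸Z⁻ ∩-⊆ʳ)
    , ⊆-∩ (⊸-swap (isLowerSet (neg-isClosed X)) (⊛⊆⇒⊆⊸ Y⁺⊛Z⁺⊆X⁻))
          (⊸-swap (isLowerSet (neg-isClosed Y)) (⊆′-trans X⁺⊆Z⁺⊸Y⁻∩Y⁺⊸Z⁻ ∩-⊆ˡ))

  chu-isStarAutonomous : IsStarAutonomous _≈ᶜ_ _⊑_ _⊗ᶜ_ Iᶜ ¬ᶜ
  chu-isStarAutonomous = record
    { isPartialOrder = ⊑-isPartialOrder
    ; isCommPomonoid = record
      { isPomonoid = record
        { mono      = λ {X} {X′} {Y} {Y′} → ⊗-mono {X} {X′} {Y} {Y′}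
        ; assoc     = λ X Y Z → ⊗-assoc⇒ X Y Z , ⊗-assoc⇐ X Y Z
        ; identityˡ = λ X → ⊗-identityˡ⇒ X , ⊗-identityˡ⇐ X
        ; identityʳ = λ X → ⊗-identityʳ⇒ X , ⊗-identityʳ⇐ X
        }
      ; comm = λ X Y → ⊗-comm X Y , ⊗-comm Y X
      }
    ; antitone    = swap
    ; involutive  = ≈ᶜ-refl
    ; adjunction⇒ = ⊗-adjunction⇒
    ; adjunction⇐ = ⊗-adjunction⇐
    }

  chu-◃-isPomonoid : IsPomonoid _≈ᶜ_ _⊑_ _◃ᶜ_ Iᶜ
  chu-◃-isPomonoid = record
    { mono      = λ (pX , nX) (pY , nY) → ◃̂-mono pX pY , ◃̂-mono nX nY
    ; assoc     = λ X Y Z → (◃̂-assoc⇒ , ◃̂-assoc⇐) , (◃̂-assoc⇐ , ◃̂-assoc⇒)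
    ; identityˡ = λ X → (K◃̂A⊆A (isLowerSet (pos-isClosed X)) , A⊆K◃̂A)
                      , (A⊆K◃̂A , K◃̂A⊆A (isLowerSet (neg-isClosed X)))
    ; identityʳ = λ X → (A◃̂K⊆A (isLowerSet (pos-isClosed X)) , A⊆A◃̂K)
                      , (A⊆A◃̂K , A◃̂K⊆A (isLowerSet (neg-isClosed X)))
    }

  ⊗-◃-interchange : ∀ W X Y Z → ((W ◃ᶜ X) ⊗ᶜ (Y ◃ᶜ Z)) ⊑ ((W ⊗ᶜ Y) ◃ᶜ (X ⊗ᶜ Z))
  ⊗-◃-interchange W X Y Z =
      ⊛-◃̂-interchange
    , ⊆-∩ (⊆′-trans (◃̂-mono ∩-⊆ˡ ∩-⊆ˡ) ◃̂-⊸-interchange)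
          (⊆′-trans (◃̂-mono ∩-⊆ʳ ∩-⊆ʳ) ◃̂-⊸-interchange)

  chu-isDuoidal : IsDuoidal _≈ᶜ_ _⊑_ _⊗ᶜ_ Iᶜ _◃ᶜ_ Iᶜ
  chu-isDuoidal = record
    { interchange = ⊗-◃-interchange
    ; jj≤j        = ⊗-identityˡ⇒ Iᶜ
    ; i≤ii        = A⊆K◃̂A , K◃̂A⊆A (isLowerSet K-isClosed)
    ; i≤j         = ⊑-refl Iᶜ
    }

  chu-&-isMeet : IsMeet _≈ᶜ_ _⊑_ _&ᶜ_
  chu-&-isMeet = record
    { lowerˡ   = λ X Y → ∩-⊆ˡ , λ x → ⊆-α x ∘ inj₁
    ; lowerʳ   = λ X Y → ∩-⊆ʳ , λ x → ⊆-α x ∘ inj₂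
    ; greatest = λ { {z = Z} (pZ⊆pX , nX⊆nZ) (pZ⊆pY , nY⊆nZ) →
        ⊆-∩ pZ⊆pX pZ⊆pY , α-least (neg-isClosed Z) (λ x → [ nX⊆nZ x , nY⊆nZ x ]′) }
    }

theorem3p48 : {c ℓ₁ ℓ₂ : Level} (𝔽 : MAVFrame c ℓ₁ ℓ₂) → ChuConstruction.ChuIsMAV 𝔽
theorem3p48 𝔽 = chuClosed , record
  { isStarAutonomous = chu-isStarAutonomous
  ; mix              = ≈ᶜ-refl Iᶜ
  ; ◃-isPomonoid     = chu-◃-isPomonoid
  ; ¬-◃              = λ X Y → ≈ᶜ-refl (¬ᶜ (X ◃ᶜ Y))
  ; isDuoidal        = chu-isDuoidal
  ; isMeet           = chu-&-isMeet
  }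
  where open MAVFrameChu 𝔽
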